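{- The weakening rule $\mathsf{w}$, which from $\mathcal{G} \mathbin{/\!/} \Gamma \vdash \Delta \mathbin{/\!/} \mathcal{H}$ infers $\mathcal{G} \mathbin{/\!/} \Gamma, \Sigma \vdash \Pi, \Delta \mathbin{/\!/} \mathcal{H}$, is height-preserving admissible in $\mathsf{LNGL}$ (i.e., if the premise has a proof of height $h$, the conclusion has a proof of height at most $h$).
   Context: A linear nested sequent is an expression $\Gamma_{1} \vdash \Delta_{1} \mathbin{/\!/} \cdots \mathbin{/\!/} \Gamma_{n} \vdash \Delta_{n}$ with $\Gamma_i,\Delta_i$ finite multisets of modal formulae (built from atoms by $\neg,\lor,\Box$); $\mathcal{G},\mathcal{H}$ denote possibly empty sequences of components. The calculus $\mathsf{LNGL}$ has the following rules ($\mathcal{G}$ a possibly empty prefix): $\mathsf{id_1}$: $\mathcal{G} \mathbin{/\!/} \Gamma, p \vdash p, \Delta$; $\mathsf{id_2}$: $\mathcal{G} \mathbin{/\!/} \Gamma, \Box\phi \vdash \Box\phi, \Delta$; $\lor\mathsf{L}$: from $\mathcal{G} \mathbin{/\!/} \Gamma, \phi \vdash \Delta$ and $\mathcal{G} \mathbin{/\!/} \Gamma, \psi \vdash \Delta$ infer $\mathcal{G} \mathbin{/\!/} \Gamma, \phi\lor\psi \vdash \Delta$; $\lor\mathsf{R}$: from $\mathcal{G} \mathbin{/\!/} \Gamma \vdash \phi,\psi,\Delta$ infer $\mathcal{G} \mathbin{/\!/} \Gamma \vdash \phi\lor\psi,\Delta$; $\neg\mathsf{L}$: from $\mathcal{G}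 \mathbin{/\!/} \Gamma \vdash \phi,\Delta$ infer $\mathcal{G} \mathbin{/\!/} \Gamma,\neg\phi \vdash \Delta$; $\neg\mathsf{R}$: from $\mathcal{G} \mathbin{/\!/} \Gamma,\phi \vdash \Delta$ infer $\mathcal{G} \mathbin{/\!/} \Gamma \vdash \neg\phi,\Delta$; $\mathsf{4L}$: from $\mathcal{G} \mathbin{/\!/} \Gamma,\Box\phi \vdash \Delta \mathbin{/\!/} \Sigma,\Box\phi \vdash \Pi$ infer $\mathcal{G} \mathbin{/\!/} \Gamma,\Box\phi \vdash \Delta \mathbin{/\!/} \Sigma \vdash \Pi$; $\Box\mathsf{L}$: from $\mathcal{G} \mathbin{/\!/} \Gamma,\Box\phi \vdash \Delta \mathbin{/\!/} \Sigma,\phi \vdash \Pi$ infer $\mathcal{G} \mathbin{/\!/} \Gamma,\Box\phi \vdash \Delta \mathbin{/\!/} \Sigma \vdash \Pi$; $\Box\mathsf{R}$: from $\mathcal{G} \mathbin{/\!/} \Gamma \vdash \Delta \mathbin{/\!/} \Box\phi \vdash \phi$ infer $\mathcal{G} \mathbin{/\!/} \Gamma \vdash \Box\phi,\Delta$. -}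

module Defs where

open import Data.Nat using (ℕ; zero; suc; _⊔_)
open import Data.List using (List; []; _∷_; _++_)
open import Data.Product using (_×_; _,_)
open import Data.List.Relation.Binary.Permutation.Propositional using (_↭_)
open import Data.List.Relation.Binary.Pointwise using (Pointwise)

infixr 6 _∨'_
infix 8 ¬'_ □_

data Fml : Set where
  atom : ℕ → Fml
  ¬'_  : Fml → Fml
  _∨'_ : Fml → Fml → Fml
  □_   : Fml → Fml

-- A component Γ ⊢ Δ : a pair of finite multisets, represented as lists
-- taken modulo permutation (see _≈C_ below).
Comp : Set
Comp = List Fml × List Fml

infix 4 _⊢_
_⊢_ : List Fml → List Fml → Comp
Γ ⊢ Δ = Γ , Δ

-- A linear nested sequent  Γ₁ ⊢ Δ₁ // ... // Γₙ ⊢ Δₙ  as the list of its components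
-- (G ++ c ∷ H  is  G // c // H).
LNS : Set
LNS = List Comp

_≈C_ : Comp → Comp → Set
(Γ , Δ) ≈C (Γ' , Δ') = (Γ ↭ Γ') × (Δ ↭ Δ')

_≈_ : LNS → LNS → Set
_≈_ = Pointwise _≈C_

data LNGL : LNS → Set where
  id₁ : ∀ {S} G Γ Δ p → S ≈ (G ++ (atom p ∷ Γ ⊢ atom p ∷ Δ) ∷ []) → LNGL S
  id₂ : ∀ {S} G Γ Δ φ → S ≈ (G ++ (□ φ ∷ Γ ⊢ □ φ ∷ Δ) ∷ []) → LNGL S
  ∨L  : ∀ {S} G Γ Δ φ ψ → S ≈ (G ++ (φ ∨' ψ ∷ Γ ⊢ Δ) ∷ []) →
        LNGL (G ++ (φ ∷ Γ ⊢ Δ) ∷ []) → LNGL (G ++ (ψ ∷ Γ ⊢ Δ) ∷ []) → LNGL S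
  ∨R  : ∀ {S} G Γ Δ φ ψ → S ≈ (G ++ (Γ ⊢ φ ∨' ψ ∷ Δ) ∷ []) →
        LNGL (G ++ (Γ ⊢ φ ∷ ψ ∷ Δ) ∷ []) → LNGL S
  ¬L  : ∀ {S} G Γ Δ φ → S ≈ (G ++ (¬' φ ∷ Γ ⊢ Δ) ∷ []) →
        LNGL (G ++ (Γ ⊢ φ ∷ Δ) ∷ []) → LNGL S
  ¬R  : ∀ {S} G Γ Δ φ → S ≈ (G ++ (Γ ⊢ ¬' φ ∷ Δ) ∷ []) →
        LNGL (G ++ (φ ∷ Γ ⊢ Δ) ∷ []) → LNGL S
  4L  : ∀ {S} G Γ Δ Σ Π φ → S ≈ (G ++ (□ φ ∷ Γ ⊢ Δ) ∷ (Σ ⊢ Π) ∷ []) →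
        LNGL (G ++ (□ φ ∷ Γ ⊢ Δ) ∷ (□ φ ∷ Σ ⊢ Π) ∷ []) → LNGL S
  □L  : ∀ {S} G Γ Δ Σ Π φ → S ≈ (G ++ (□ φ ∷ Γ ⊢ Δ) ∷ (Σ ⊢ Π) ∷ []) →
        LNGL (G ++ (□ φ ∷ Γ ⊢ Δ) ∷ (φ ∷ Σ ⊢ Π) ∷ []) → LNGL S
  □R  : ∀ {S} G Γ Δ φ → S ≈ (G ++ (Γ ⊢ □ φ ∷ Δ) ∷ []) →
        LNGL (G ++ (Γ ⊢ Δ) ∷ (□ φ ∷ [] ⊢ φ ∷ []) ∷ []) → LNGL S

height : ∀ {S} → LNGL S → ℕ
height (id₁ _ _ _ _ _) = 0
height (id₂ _ _ _ _ _) = 0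
height (∨L _ _ _ _ _ _ d e) = suc (height d ⊔ height e)
height (∨R _ _ _ _ _ _ d) = suc (height d)
height (¬L _ _ _ _ _ d) = suc (height d)
height (¬R _ _ _ _ _ d) = suc (height d)
height (4L _ _ _ _ _ _ _ d) = suc (height d)
height (□L _ _ _ _ _ _ _ d) = suc (height d)
height (□R _ _ _ _ _ d) = suc (height d)

-- Every rule inspects only the
-- last one or two components of its conclusion, and only up to permutation,
-- so formulae added to a component can ride along in the rule's side contexts
-- Γ, Δ, Σ, Π, and initial sequents stay initial.  As the weakened component
-- may lie anywhere in a rule's prefix G, the induction proves the statement
-- for every componentwise weakening S ⊑* T, carrying it up to the premises.
module Submission where

open import Defs
open import Data.Nat using (_≤_; z≤n; s≤s)
open import Data.Nat.Properties using (⊔-mono-≤)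
open import Data.List using (List; []; _∷_; _++_)
open import Data.Product using (Σ-syntax; ∃-syntax; ∃₂; _×_; _,_)
open import Relation.Binary.Definitions using (_Respectsˡ_)
open import Relation.Binary.PropositionalEquality using (_≡_; refl)
open import Data.List.Relation.Binary.Permutation.Propositional using (↭-refl; ↭-sym; ↭-trans)
open import Data.List.Relation.Binary.Permutation.Propositional.Properties using (++⁺ʳ; ++-identityʳ; ++-comm)
open import Data.List.Relation.Binary.Pointwise as Pointwise using (Pointwise; []; _∷_; respˡ)

infix 4 _⊑_ _⊑*_

_⊑_ : Comp → Comp → Set
(Γ , Δ) ⊑ c = ∃₂ λ A B → c ≈C (Γ ++ A ⊢ Δ ++ B)

_⊑*_ : LNS → LNS → Set
_⊑*_ = Pointwise _⊑_

⊑-++ : ∀ {Γ Δ} A B → (Γ ⊢ Δ) ⊑ (Γ ++ A ⊢ Δ ++ B)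
⊑-++ A B = A , B , ↭-refl , ↭-refl

⊑-refl : ∀ {c} → c ⊑ c
⊑-refl {Γ , Δ} = [] , [] , ↭-sym (++-identityʳ Γ) , ↭-sym (++-identityʳ Δ)

⊑*-refl : ∀ {S} → S ⊑* S
⊑*-refl = Pointwise.refl ⊑-refl

≈-refl : ∀ {S} → S ≈ S
≈-refl = Pointwise.refl (↭-refl , ↭-refl)

⊑-respˡ-≈C : _⊑_ Respectsˡ _≈C_
⊑-respˡ-≈C {_ , _} {_ , _} {_ , _} (Γ↭ , Δ↭) (A , B , Σ↭ , Π↭) =
  A , B , ↭-trans Σ↭ (++⁺ʳ A Γ↭) , ↭-trans Π↭ (++⁺ʳ B Δ↭)

⊑*-respˡ-≈ : _⊑*_ Respectsˡ _≈_
⊑*-respˡ-≈ = respˡ ⊑-respˡ-≈C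

⊑*-++⁻ : ∀ G {L T} → (G ++ L) ⊑* T →
  ∃₂ λ TG TL → T ≡ TG ++ TL × G ⊑* TG × L ⊑* TL
⊑*-++⁻ []      {T = T} L⊑ = [] , T , refl , [] , L⊑
⊑*-++⁻ (_ ∷ G) (c⊑ ∷ w) with ⊑*-++⁻ G w
... | TG , TL , refl , G⊑ , L⊑ = _ ∷ TG , TL , refl , c⊑ ∷ G⊑ , L⊑

⊑*-last⁻ : ∀ G {Γ Δ T} → (G ++ (Γ ⊢ Δ) ∷ []) ⊑* T →
  ∃[ TG ] ∃₂ λ A B → G ⊑* TG × T ≈ (TG ++ (Γ ++ A ⊢ Δ ++ B) ∷ [])
⊑*-last⁻ G w with ⊑*-++⁻ G w
... | TG , _ ∷ [] , refl , G⊑ , (A , B , c≈) ∷ [] =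
  TG , A , B , G⊑ , Pointwise.++⁺ ≈-refl (c≈ ∷ [])

⊑*-last₂⁻ : ∀ G {Γ Δ Σ Π T} → (G ++ (Γ ⊢ Δ) ∷ (Σ ⊢ Π) ∷ []) ⊑* T →
  ∃[ TG ] ∃₂ λ A B → ∃₂ λ C D →
    G ⊑* TG × T ≈ (TG ++ (Γ ++ A ⊢ Δ ++ B) ∷ (Σ ++ C ⊢ Π ++ D) ∷ [])
⊑*-last₂⁻ G w with ⊑*-++⁻ G w
... | TG , _ ∷ _ ∷ [] , refl , G⊑ , (A , B , c≈) ∷ (C , D , c'≈) ∷ [] =
  TG , A , B , C , D , G⊑ , Pointwise.++⁺ ≈-refl (c≈ ∷ c'≈ ∷ [])

weaken : ∀ {S T} → S ⊑* T → (d : LNGL S) → Σ[ d' ∈ LNGL T ] height d' ≤ height d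
weaken w (id₁ G Γ Δ p e) with ⊑*-last⁻ G (⊑*-respˡ-≈ e w)
... | TG , A , B , _ , T≈ = id₁ TG (Γ ++ A) (Δ ++ B) p T≈ , z≤n
weaken w (id₂ G Γ Δ φ e) with ⊑*-last⁻ G (⊑*-respˡ-≈ e w)
... | TG , A , B , _ , T≈ = id₂ TG (Γ ++ A) (Δ ++ B) φ T≈ , z≤n
weaken w (∨L G Γ Δ φ ψ e d₁ d₂) with ⊑*-last⁻ G (⊑*-respˡ-≈ e w)
... | TG , A , B , G⊑ , T≈ =
  let d₁' , h₁ = weaken (Pointwise.++⁺ G⊑ (⊑-++ A B ∷ [])) d₁
      d₂' , h₂ = weaken (Pointwise.++⁺ G⊑ (⊑-++ A B ∷ [])) d₂
  in ∨L TG (Γ ++ A) (Δ ++ B) φ ψ T≈ d₁' d₂' , s≤s (⊔-mono-≤ h₁ h₂)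
weaken w (∨R G Γ Δ φ ψ e d) with ⊑*-last⁻ G (⊑*-respˡ-≈ e w)
... | TG , A , B , G⊑ , T≈ =
  let d' , h = weaken (Pointwise.++⁺ G⊑ (⊑-++ A B ∷ [])) d
  in ∨R TG (Γ ++ A) (Δ ++ B) φ ψ T≈ d' , s≤s h
weaken w (¬L G Γ Δ φ e d) with ⊑*-last⁻ G (⊑*-respˡ-≈ e w)
... | TG , A , B , G⊑ , T≈ =
  let d' , h = weaken (Pointwise.++⁺ G⊑ (⊑-++ A B ∷ [])) d
  in ¬L TG (Γ ++ A) (Δ ++ B) φ T≈ d' , s≤s h
weaken w (¬R G Γ Δ φ e d) with ⊑*-last⁻ G (⊑*-respˡ-≈ e w)
... | TG , A , B , G⊑ , T≈ =
  let d' , h = weaken (Pointwise.++⁺ G⊑ (⊑-++ A B ∷ [])) d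
  in ¬R TG (Γ ++ A) (Δ ++ B) φ T≈ d' , s≤s h
weaken w (□R G Γ Δ φ e d) with ⊑*-last⁻ G (⊑*-respˡ-≈ e w)
... | TG , A , B , G⊑ , T≈ =
  let d' , h = weaken (Pointwise.++⁺ G⊑ (⊑-++ A B ∷ ⊑-refl ∷ [])) d
  in □R TG (Γ ++ A) (Δ ++ B) φ T≈ d' , s≤s h
weaken w (4L G Γ Δ Σ Π φ e d) with ⊑*-last₂⁻ G (⊑*-respˡ-≈ e w)
... | TG , A , B , C , D , G⊑ , T≈ =
  let d' , h = weaken (Pointwise.++⁺ G⊑ (⊑-++ A B ∷ ⊑-++ C D ∷ [])) d
  in 4L TG (Γ ++ A) (Δ ++ B) (Σ ++ C) (Π ++ D) φ T≈ d' , s≤s h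
weaken w (□L G Γ Δ Σ Π φ e d) with ⊑*-last₂⁻ G (⊑*-respˡ-≈ e w)
... | TG , A , B , C , D , G⊑ , T≈ =
  let d' , h = weaken (Pointwise.++⁺ G⊑ (⊑-++ A B ∷ ⊑-++ C D ∷ [])) d
  in □L TG (Γ ++ A) (Δ ++ B) (Σ ++ C) (Π ++ D) φ T≈ d' , s≤s h

lemma4p2 : (G H : LNS) (Γ Δ Σ' Π : List Fml)
    → (d : LNGL (G ++ (Γ ⊢ Δ) ∷ H))
    → Σ[ d' ∈ LNGL (G ++ (Γ ++ Σ' ⊢ Π ++ Δ) ∷ H) ] height d' ≤ height d
lemma4p2 G H Γ Δ Σ' Π =
  weaken (Pointwise.++⁺ ⊑*-refl ((Σ' , Π , ↭-refl , ++-comm Π Δ) ∷ ⊑*-refl))
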